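{- Let $G$ be a graph with $n$ vertices and minimum degree $\delta(G)$. Then $$d(G,n-\delta(G)-1)=\binom{n}{\delta(G)+1}-\bigl|\{N[v]:\deg(v)=\delta(G)\}\bigr|,$$ where $N[v]$ denotes the closed neighbourhood of $v$ (so the right-hand set counts distinct closed neighbourhoods of minimum-degree vertices).
   Context: All graphs are finite and simple. A set $S$ of vertices of a graph $G$ is dominating if every vertex of $G$ is in $S$ or adjacent to a vertex of $S$. $d(G,i)$ is the number of dominating sets of $G$ of cardinality $i$. -}

module Defs where

open import Data.Nat using (ℕ; zero; suc; _⊓_)
open import Data.Nat.Properties using () renaming (_≟_ to _≟ℕ_)
open import Data.Bool using (Bool; true; false)
open import Data.Bool.Properties using () renaming (_≟_ to _≟B_)
open import Data.Fin using (Fin)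
open import Data.Fin.Properties using (any?; all?)
open import Data.Fin.Subset using (Subset; _∈_; ∣_∣; ⁅_⁆; _∪_; inside; outside)
open import Data.Fin.Subset.Properties using (_∈?_)
open import Data.Vec using (Vec; tabulate; []; _∷_)
open import Data.Vec.Properties using (≡-dec)
open import Data.List using (List; []; _∷_; _++_; map; filter; length; foldr; allFin)
open import Data.List using () renaming (map to mapL)
open import Data.Product using (∃; _×_; _,_)
open import Data.Sum using (_⊎_)
open import Relation.Nullary using (Dec)
open import Relation.Nullary.Decidable using (_⊎-dec_; _×-dec_)
open import Relation.Binary.PropositionalEquality using (_≡_)
open import Data.Vec using () renaming (toList to vtoList)

record Graph (n : ℕ) : Set where
  field
    adj    : Fin n → Fin n → Bool
    sym    : ∀ u v → adj u v ≡ adj v u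
    irrefl : ∀ v → adj v v ≡ false
open Graph public

allSubsets : (n : ℕ) → List (Subset n)
allSubsets zero = [] ∷ []
allSubsets (suc n) = mapL (inside ∷_) (allSubsets n) ++ mapL (outside ∷_) (allSubsets n)

module _ {n : ℕ} (G : Graph n) where

  nbhd : Fin n → Subset n
  nbhd v = tabulate (adj G v)

  closedNbhd : Fin n → Subset n
  closedNbhd v = ⁅ v ⁆ ∪ nbhd v

  deg : Fin n → ℕ
  deg v = ∣ nbhd v ∣

  Dominating : Subset n → Set
  Dominating S = ∀ v → v ∈ S ⊎ ∃ λ u → u ∈ S × adj G u v ≡ true

  dominating? : (S : Subset n) → Dec (Dominating S)
  dominating? S = all? (λ v → (v ∈? S) ⊎-dec any? (λ u → (u ∈? S) ×-dec (adj G u v ≟B true)))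

  d : ℕ → ℕ
  d i = length (filter (λ S → dominating? S ×-dec (∣ S ∣ ≟ℕ i)) (allSubsets n))

minDeg : {m : ℕ} → Graph (suc m) → ℕ
minDeg {m} G = foldr _⊓_ (deg G Fin.zero) (mapL (deg G) (allFin (suc m)))

numMinClosedNbhds : {m : ℕ} → Graph (suc m) → ℕ
numMinClosedNbhds {m} G =
  length (filter (λ S → any? (λ v → (deg G v ≟ℕ minDeg G) ×-dec (≡-dec _≟B_ (closedNbhd G v) S)))
                 (allSubsets (suc m)))

module Submission where

-- Let n = |V(G)|, δ = δ(G) and k = n - (δ + 1).  A set S fails to dominate
-- a vertex v exactly when the closed neighbourhood N[v] misses S, i.e.
-- N[v] ⊆ ∁S.  If |S| = k then |∁S| = δ + 1 ≤ deg v + 1 = |N[v]|, so the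
-- inclusion forces N[v] = ∁S and deg v = δ; conversely every such ∁S
-- gives a non-dominating k-set.  Complementation is therefore a bijection
-- between non-dominating k-sets and the distinct closed neighbourhoods of
-- minimum-degree vertices, so  d(G,k) + |{N[v] : deg v = δ}| = C(n,k),
-- and C(n,k) = C(n,δ+1) by symmetry of binomial coefficients.

open import Defs hiding (sym)
open import Data.Nat using (ℕ; suc; zero; _∸_; _+_; _≤_; _⊓_; s≤s)
open import Data.Nat.Properties
  using (+-comm; +-suc; ∸-+-assoc; m∸[m∸n]≡n; m+n∸n≡m; ≤-trans; m⊓n≤m; m⊓n≤n; suc-injective; <-irrefl)
  renaming (_≟_ to _≟ℕ_)
open import Data.Nat.Combinatorics using (_C_; nCk≡nC[n∸k]; nCk+nC[k+1]≡[n+1]C[k+1])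
open import Data.Bool using (true; not)
open import Data.Bool.Properties using (not-involutive) renaming (_≟_ to _≟B_)
open import Data.Fin using (Fin)
open import Data.Fin.Properties using (any?; ¬∀⟶∃¬)
open import Data.Fin.Subset using (Subset; _∈_; _∉_; _⊆_; ∣_∣; ⁅_⁆; _∪_; ∁; inside; outside)
open import Data.Fin.Subset.Properties
  using (_∈?_; ⊆-refl; drop-∷-⊆; p⊆q⇒∣p∣≤∣q∣; ∣∁p∣≡n∸∣p∣; ∣p∣≤n; ∪-identityˡ;
         x∈∁p⇒x∉p; x∉p⇒x∈∁p; x∈⁅x⁆; x∈⁅y⁆⇒x≡y; x∈p∪q⁻; x∈p∪q⁺)
open import Data.Vec using ([]; _∷_; tabulate; map; here; there)
open import Data.Vec.Properties using (≡-dec; map-∘; map-cong; map-id; lookup∘tabulate; []=⇒lookup; lookup⇒[]=)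
open import Data.List using (List; []; _∷_; _++_; filter; length; foldr; allFin) renaming (map to mapL)
open import Data.List.Properties using (filter-++; filter-≐; filter-none; length-++)
open import Data.List.Relation.Unary.All using (universal)
open import Data.List.Membership.Propositional using () renaming (_∈_ to _∈L_)
open import Data.List.Membership.Propositional.Properties using (∈-allFin)
open import Data.List.Relation.Unary.Any using () renaming (here to hereL; there to thereL)
open import Data.Product using (∃; _×_; _,_)
open import Data.Sum using (_⊎_; inj₁; inj₂)
open import Data.Empty using (⊥-elim)
open import Relation.Nullary using (yes; no; ¬_; ¬?)
open import Relation.Nullary.Decidable using (_⊎-dec_; _×-dec_)
open import Relation.Unary using (Decidable; _≐_)
open import Relation.Binary.PropositionalEquality
  using (_≡_; refl; sym; trans; cong; cong₂; subst; subst₂; module ≡-Reasoning)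
open import Function using (_∘_)

open ≡-Reasoning

count : {A : Set} {P : A → Set} → Decidable P → List A → ℕ
count P? xs = length (filter P? xs)

count-cong : {A : Set} {P Q : A → Set} (P? : Decidable P) (Q? : Decidable Q) →
             P ≐ Q → (xs : List A) → count P? xs ≡ count Q? xs
count-cong P? Q? P≐Q xs = cong length (filter-≐ P? Q? P≐Q xs)

count-none : {A : Set} {P : A → Set} (P? : Decidable P) →
             (∀ x → ¬ P x) → (xs : List A) → count P? xs ≡ 0
count-none P? ¬P xs = cong length (filter-none P? (universal ¬P xs))

count-++ : {A : Set} {P : A → Set} (P? : Decidable P) (xs ys : List A) →
           count P? (xs ++ ys) ≡ count P? xs + count P? ys
count-++ P? xs ys = trans (cong length (filter-++ P? xs ys)) (length-++ (filter P? xs))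

count-map : {A B : Set} {P : B → Set} (P? : Decidable P) (f : A → B) (xs : List A) →
            count P? (mapL f xs) ≡ count (P? ∘ f) xs
count-map P? f [] = refl
count-map P? f (x ∷ xs) with P? (f x)
... | yes _ = cong suc (count-map P? f xs)
... | no _  = count-map P? f xs

count-split : {A : Set} {D E : A → Set} (D? : Decidable D) (E? : Decidable E) (xs : List A) →
              count (λ x → D? x ×-dec E? x) xs + count (λ x → ¬? (D? x) ×-dec E? x) xs ≡ count E? xs
count-split D? E? [] = refl
count-split D? E? (x ∷ xs) with D? x | E? x
... | yes _ | yes _ = cong suc (count-split D? E? xs)
... | yes _ | no _  = count-split D? E? xs
... | no _  | no _  = count-split D? E? xs
... | no _  | yes _ = trans (+-suc _ _) (cong suc (count-split D? E? xs))

count-allSubsets-suc : (n : ℕ) {P : Subset (suc n) → Set} (P? : Decidable P) →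
  count P? (allSubsets (suc n))
    ≡ count (P? ∘ (inside ∷_)) (allSubsets n) + count (P? ∘ (outside ∷_)) (allSubsets n)
count-allSubsets-suc n P? =
  trans (count-++ P? (mapL (inside ∷_) A) (mapL (outside ∷_) A))
        (cong₂ _+_ (count-map P? (inside ∷_) A) (count-map P? (outside ∷_) A))
  where
  A : List (Subset n)
  A = allSubsets n

-- Complementation permutes the subsets, so it preserves every count.
count-∁ : (n : ℕ) {P : Subset n → Set} (P? : Decidable P) →
          count P? (allSubsets n) ≡ count (P? ∘ ∁) (allSubsets n)
count-∁ zero P? with P? []
... | yes _ = refl
... | no _  = refl
count-∁ (suc n) P? = begin
  count P? (allSubsets (suc n))
    ≡⟨ count-allSubsets-suc n P? ⟩
  count (P? ∘ (inside ∷_)) A + count (P? ∘ (outside ∷_)) A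
    ≡⟨ cong₂ _+_ (count-∁ n (P? ∘ (inside ∷_))) (count-∁ n (P? ∘ (outside ∷_))) ⟩
  count (P? ∘ (inside ∷_) ∘ ∁) A + count (P? ∘ (outside ∷_) ∘ ∁) A
    ≡⟨ +-comm (count (P? ∘ (inside ∷_) ∘ ∁) A) _ ⟩
  count (P? ∘ ∁ ∘ (inside ∷_)) A + count (P? ∘ ∁ ∘ (outside ∷_)) A
    ≡⟨ count-allSubsets-suc n (P? ∘ ∁) ⟨
  count (P? ∘ ∁) (allSubsets (suc n)) ∎
  where
  A : List (Subset n)
  A = allSubsets n

count-size : (n k : ℕ) → count (λ S → ∣ S ∣ ≟ℕ k) (allSubsets n) ≡ n C k
count-size zero zero    = refl
count-size zero (suc k) = refl
count-size (suc n) k = trans (count-allSubsets-suc n (λ S → ∣ S ∣ ≟ℕ k)) (pascal k)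
  where
  A : List (Subset n)
  A = allSubsets n
  -- Pascal's rule: a k-subset of Fin (suc n) contains 0 or not.
  pascal : (k : ℕ) → count (λ S → suc ∣ S ∣ ≟ℕ k) A + count (λ S → ∣ S ∣ ≟ℕ k) A ≡ suc n C k
  pascal zero = cong₂ _+_ (count-none (λ S → suc ∣ S ∣ ≟ℕ 0) (λ _ ()) A) (count-size n 0)
  pascal (suc k) = begin
    count (λ S → suc ∣ S ∣ ≟ℕ suc k) A + count (λ S → ∣ S ∣ ≟ℕ suc k) A
      ≡⟨ cong (_+ count (λ S → ∣ S ∣ ≟ℕ suc k) A)
              (count-cong (λ S → suc ∣ S ∣ ≟ℕ suc k) (λ S → ∣ S ∣ ≟ℕ k) (suc-injective , cong suc) A) ⟩
    count (λ S → ∣ S ∣ ≟ℕ k) A + count (λ S → ∣ S ∣ ≟ℕ suc k) A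
      ≡⟨ cong₂ _+_ (count-size n k) (count-size n (suc k)) ⟩
    n C k + n C suc k
      ≡⟨ nCk+nC[k+1]≡[n+1]C[k+1] n k ⟩
    suc n C suc k ∎

∁-involutive : {n : ℕ} (p : Subset n) → ∁ (∁ p) ≡ p
∁-involutive p = begin
  map not (map not p) ≡⟨ map-∘ not not p ⟨
  map (not ∘ not) p   ≡⟨ map-cong not-involutive p ⟩
  map (λ b → b) p     ≡⟨ map-id p ⟩
  p                   ∎

∣⁅x⁆∪p∣≡1+∣p∣ : {n : ℕ} (x : Fin n) (p : Subset n) → x ∉ p → ∣ ⁅ x ⁆ ∪ p ∣ ≡ suc ∣ p ∣
∣⁅x⁆∪p∣≡1+∣p∣ Fin.zero    (outside ∷ p) _   = cong (suc ∘ ∣_∣) (∪-identityˡ p)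
∣⁅x⁆∪p∣≡1+∣p∣ Fin.zero    (inside ∷ p)  x∉p = ⊥-elim (x∉p here)
∣⁅x⁆∪p∣≡1+∣p∣ (Fin.suc x) (inside ∷ p)  x∉p = cong suc (∣⁅x⁆∪p∣≡1+∣p∣ x p (x∉p ∘ there))
∣⁅x⁆∪p∣≡1+∣p∣ (Fin.suc x) (outside ∷ p) x∉p = ∣⁅x⁆∪p∣≡1+∣p∣ x p (x∉p ∘ there)

⊆-card-antisym : {n : ℕ} {p q : Subset n} → p ⊆ q → ∣ q ∣ ≤ ∣ p ∣ → p ≡ q
⊆-card-antisym {p = []}          {[]}          _   _         = refl
⊆-card-antisym {p = inside ∷ p}  {inside ∷ q}  p⊆q (s≤s q≤p) = cong (inside ∷_) (⊆-card-antisym (drop-∷-⊆ p⊆q) q≤p)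
⊆-card-antisym {p = outside ∷ p} {outside ∷ q} p⊆q q≤p       = cong (outside ∷_) (⊆-card-antisym (drop-∷-⊆ p⊆q) q≤p)
⊆-card-antisym {p = inside ∷ p}  {outside ∷ q} p⊆q _ with p⊆q here
... | ()
⊆-card-antisym {p = outside ∷ p} {inside ∷ q}  p⊆q q≤p =
  ⊥-elim (<-irrefl refl (≤-trans q≤p (p⊆q⇒∣p∣≤∣q∣ (drop-∷-⊆ p⊆q))))

foldr⊓-map-≤ : {A : Set} (f : A → ℕ) (z : ℕ) (xs : List A) {x : A} →
               x ∈L xs → foldr _⊓_ z (mapL f xs) ≤ f x
foldr⊓-map-≤ f z (y ∷ xs) (hereL refl) = m⊓n≤m (f y) _
foldr⊓-map-≤ f z (y ∷ xs) (thereL x∈xs) = ≤-trans (m⊓n≤n (f y) _) (foldr⊓-map-≤ f z xs x∈xs)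

module _ {n : ℕ} (G : Graph n) where

  ∈-nbhd⁺ : {v u : Fin n} → adj G v u ≡ true → u ∈ nbhd G v
  ∈-nbhd⁺ {v} {u} vu = lookup⇒[]= u (tabulate (adj G v)) (trans (lookup∘tabulate (adj G v) u) vu)

  ∈-nbhd⁻ : {v u : Fin n} → u ∈ nbhd G v → adj G v u ≡ true
  ∈-nbhd⁻ {v} {u} u∈N = trans (sym (lookup∘tabulate (adj G v) u)) ([]=⇒lookup u∈N)

  ∉-nbhd-self : (v : Fin n) → v ∉ nbhd G v
  ∉-nbhd-self v v∈N with trans (sym (∈-nbhd⁻ v∈N)) (irrefl G v)
  ... | ()

  ∣closedNbhd∣ : (v : Fin n) → ∣ closedNbhd G v ∣ ≡ suc (deg G v)
  ∣closedNbhd∣ v = ∣⁅x⁆∪p∣≡1+∣p∣ v (nbhd G v) (∉-nbhd-self v)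

  closedNbhd⊆∁⇒¬Dominating : {S : Subset n} (v : Fin n) → closedNbhd G v ⊆ ∁ S → ¬ Dominating G S
  closedNbhd⊆∁⇒¬Dominating {S} v N[v]⊆∁S dom with dom v
  ... | inj₁ v∈S = x∈∁p⇒x∉p (N[v]⊆∁S (x∈p∪q⁺ (inj₁ (x∈⁅x⁆ v)))) v∈S
  ... | inj₂ (u , u∈S , uv) =
    x∈∁p⇒x∉p (N[v]⊆∁S (x∈p∪q⁺ {p = ⁅ v ⁆} (inj₂ (∈-nbhd⁺ (trans (Graph.sym G v u) uv))))) u∈S

  dominatedBy? : (S : Subset n) → Decidable (λ v → v ∈ S ⊎ ∃ λ u → u ∈ S × adj G u v ≡ true)
  dominatedBy? S v = (v ∈? S) ⊎-dec any? (λ u → (u ∈? S) ×-dec (adj G u v ≟B true))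

  ¬Dominating⇒closedNbhd⊆∁ : {S : Subset n} → ¬ Dominating G S → ∃ λ v → closedNbhd G v ⊆ ∁ S
  ¬Dominating⇒closedNbhd⊆∁ {S} ¬dom with ¬∀⟶∃¬ n _ (dominatedBy? S) ¬dom
  ... | v , ¬dominated = v , λ x∈N → x∉p⇒x∈∁p (misses (x∈p∪q⁻ ⁅ v ⁆ (nbhd G v) x∈N))
    where
    misses : {x : Fin n} → x ∈ ⁅ v ⁆ ⊎ x ∈ nbhd G v → x ∉ S
    misses (inj₁ x∈⁅v⁆) x∈S = ¬dominated (inj₁ (subst (_∈ S) (x∈⁅y⁆⇒x≡y v x∈⁅v⁆) x∈S))
    misses {x} (inj₂ x∈N) x∈S = ¬dominated (inj₂ (x , x∈S , trans (Graph.sym G x v) (∈-nbhd⁻ x∈N)))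

module _ {m : ℕ} (G : Graph (suc m)) where

  private
    n δ : ℕ
    n = suc m
    δ = minDeg G

  minDeg≤deg : (v : Fin n) → δ ≤ deg G v
  minDeg≤deg v = foldr⊓-map-≤ (deg G) (deg G Fin.zero) (allFin n) (∈-allFin v)

  -- δ + 1 ≤ n, as witnessed by the closed neighbourhood of any vertex.
  minDeg<n : suc δ ≤ n
  minDeg<n = ≤-trans (s≤s (minDeg≤deg Fin.zero))
                     (subst (_≤ n) (∣closedNbhd∣ G Fin.zero) (∣p∣≤n (closedNbhd G Fin.zero)))

  IsMinClosedNbhd : Subset n → Set
  IsMinClosedNbhd T = ∃ λ v → deg G v ≡ δ × closedNbhd G v ≡ T

  isMinClosedNbhd? : Decidable IsMinClosedNbhd
  isMinClosedNbhd? T = any? (λ v → (deg G v ≟ℕ δ) ×-dec (≡-dec _≟B_ (closedNbhd G v) T))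

  ∁-nonDominating : {S : Subset n} → ¬ Dominating G S → ∣ S ∣ ≡ n ∸ suc δ → IsMinClosedNbhd (∁ S)
  ∁-nonDominating {S} ¬dom ∣S∣ with ¬Dominating⇒closedNbhd⊆∁ G ¬dom
  ... | v , N[v]⊆∁S = v , deg-v , N[v]≡∁S
    where
    ∣∁S∣ : ∣ ∁ S ∣ ≡ suc δ
    ∣∁S∣ = trans (∣∁p∣≡n∸∣p∣ S) (trans (cong (n ∸_) ∣S∣) (m∸[m∸n]≡n minDeg<n))
    N[v]≡∁S : closedNbhd G v ≡ ∁ S
    N[v]≡∁S = ⊆-card-antisym N[v]⊆∁S
      (subst₂ _≤_ (sym ∣∁S∣) (sym (∣closedNbhd∣ G v)) (s≤s (minDeg≤deg v)))
    deg-v : deg G v ≡ δ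
    deg-v = suc-injective (trans (sym (∣closedNbhd∣ G v)) (trans (cong ∣_∣ N[v]≡∁S) ∣∁S∣))

  nonDominating-∁ : {S : Subset n} → IsMinClosedNbhd (∁ S) → ¬ Dominating G S × ∣ S ∣ ≡ n ∸ suc δ
  nonDominating-∁ {S} (v , deg-v , N[v]≡∁S) =
    closedNbhd⊆∁⇒¬Dominating G v (subst (closedNbhd G v ⊆_) N[v]≡∁S ⊆-refl) , ∣S∣
    where
    ∣S∣ : ∣ S ∣ ≡ n ∸ suc δ
    ∣S∣ = begin
      ∣ S ∣                  ≡⟨ cong ∣_∣ (∁-involutive S) ⟨
      ∣ ∁ (∁ S) ∣            ≡⟨ ∣∁p∣≡n∸∣p∣ (∁ S) ⟩
      n ∸ ∣ ∁ S ∣            ≡⟨ cong (λ T → n ∸ ∣ T ∣) N[v]≡∁S ⟨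
      n ∸ ∣ closedNbhd G v ∣ ≡⟨ cong (n ∸_) (∣closedNbhd∣ G v) ⟩
      n ∸ suc (deg G v)      ≡⟨ cong (λ e → n ∸ suc e) deg-v ⟩
      n ∸ suc δ              ∎

  count-nonDominating :
    count (λ S → ¬? (dominating? G S) ×-dec (∣ S ∣ ≟ℕ n ∸ suc δ)) (allSubsets n) ≡ numMinClosedNbhds G
  count-nonDominating =
    trans (count-cong (λ S → ¬? (dominating? G S) ×-dec (∣ S ∣ ≟ℕ n ∸ suc δ)) (isMinClosedNbhd? ∘ ∁)
                      ((λ (¬dom , ∣S∣) → ∁-nonDominating ¬dom ∣S∣) , nonDominating-∁) (allSubsets n))
          (sym (count-∁ n isMinClosedNbhd?))

  dominating+nonDominating : d G (n ∸ suc δ) + numMinClosedNbhds G ≡ n C suc δ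
  dominating+nonDominating = begin
    d G (n ∸ suc δ) + numMinClosedNbhds G
      ≡⟨ cong (d G (n ∸ suc δ) +_) count-nonDominating ⟨
    d G (n ∸ suc δ) + count (λ S → ¬? (dominating? G S) ×-dec (∣ S ∣ ≟ℕ n ∸ suc δ)) (allSubsets n)
      ≡⟨ count-split (dominating? G) (λ S → ∣ S ∣ ≟ℕ n ∸ suc δ) (allSubsets n) ⟩
    count (λ S → ∣ S ∣ ≟ℕ n ∸ suc δ) (allSubsets n)
      ≡⟨ count-size n (n ∸ suc δ) ⟩
    n C (n ∸ suc δ)
      ≡⟨ nCk≡nC[n∸k] minDeg<n ⟨
    n C suc δ ∎

lemma2p7 : (m : ℕ) (G : Graph (suc m)) →
    d G (suc m ∸ minDeg G ∸ 1) ≡ (suc m C (minDeg G + 1)) ∸ numMinClosedNbhds G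
lemma2p7 m G = begin
  d G (n ∸ δ ∸ 1)            ≡⟨ cong (d G) (trans (∸-+-assoc n δ 1) (cong (n ∸_) δ+1≡1+δ)) ⟩
  d G (n ∸ suc δ)            ≡⟨ m+n∸n≡m (d G (n ∸ suc δ)) N ⟨
  d G (n ∸ suc δ) + N ∸ N    ≡⟨ cong (_∸ N) (dominating+nonDominating G) ⟩
  n C suc δ ∸ N              ≡⟨ cong (λ k → n C k ∸ N) δ+1≡1+δ ⟨
  n C (δ + 1) ∸ N            ∎
  where
  n δ N : ℕ
  n = suc m
  δ = minDeg G
  N = numMinClosedNbhds G
  δ+1≡1+δ : δ + 1 ≡ suc δ
  δ+1≡1+δ = +-comm δ 1
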